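{- For every non-negative integer $N$, \[\sum_{\pi\in\mathcal{D}_{\le N}} q^{\mathcal{O}(\pi)} = \sum_{i=0}^N {N\brack i}_q q^i,\qquad \sum_{\pi\in\mathcal{P}_{\le N}} q^{\mathcal{O}(\pi)} = \sum_{i=0}^N \frac{q^i}{(q;q)_i(q;q)_{N-i}}.\]
   Context: A partition $\pi=(\lambda_1,\lambda_2,\dots)$ is a finite non-increasing sequence of positive integers; the empty sequence is the unique partition of $0$. $\mathcal{P}_{\le N}$ is the set of partitions with all parts $\le N$, $\mathcal{D}_{\le N}$ the set of partitions into distinct parts all $\le N$. $\mathcal{O}(\pi)=\lambda_1+\lambda_3+\lambda_5+\cdots$. $(a;q)_l=\prod_{i=0}^{l-1}(1-aq^i)$ and ${n+m\brack n}_q=\frac{(q;q)_{n+m}}{(q;q)_n(q;q)_m}$ for $n,m\ge0$, $0$ otherwise. Identities of formal power series in $q$. -}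

module Defs where

open import Data.Nat as ℕ using (ℕ; zero; suc; _≤_; _<_; _>_; _≥_; _∸_)
open import Data.Integer as ℤ using (ℤ; +_; -_)
open import Data.List using (List; []; _∷_; map; upTo; zipWith; foldr)
open import Data.List.Relation.Unary.All using (All)
open import Data.List.Relation.Unary.Linked using (Linked)
open import Data.Fin using (Fin)
open import Data.Product using (Σ; _×_)
open import Function.Bundles using (_↔_)
open import Relation.Binary.PropositionalEquality using (_≡_)
import Relation.Nullary

IsPartition : List ℕ → Set
IsPartition π = All (1 ≤_) π × Linked _≥_ π

InP≤ : ℕ → List ℕ → Set
InP≤ N π = IsPartition π × All (_≤ N) π

-- 𝒟_{≤N}: partitions into distinct parts, all parts ≤ N
-- (distinct parts of a non-increasing sequence = strictly decreasing)
InD≤ : ℕ → List ℕ → Set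
InD≤ N π = IsPartition π × Linked _>_ π × All (_≤ N) π

𝒪 : List ℕ → ℕ
𝒪 []            = 0
𝒪 (x ∷ [])      = x
𝒪 (x ∷ _ ∷ r)   = x ℕ.+ 𝒪 r

Series : Set
Series = ℕ → ℤ

sumℤ : List ℤ → ℤ
sumℤ = foldr ℤ._+_ (+ 0)

_⊕_ : Series → Series → Series
(f ⊕ g) n = f n ℤ.+ g n

_⊛_ : Series → Series → Series
(f ⊛ g) n = sumℤ (map (λ k → f k ℤ.* g (n ∸ k)) (upTo (suc n)))

infixl 6 _⊕_
infixl 7 _⊛_

one : Series
one zero    = + 1
one (suc _) = + 0

qpow : ℕ → Series
qpow i n with i ℕ.≟ n
... | Relation.Nullary.yes _ = + 1
... | Relation.Nullary.no _  = + 0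

oneMinusQ^ : ℕ → Series
oneMinusQ^ i n = one n ℤ.- qpow i n

sumTo : ℕ → (ℕ → Series) → Series
sumTo N f n = sumℤ (map (λ i → f i n) (upTo (suc N)))

-- (q;q)_l = ∏_{i=0}^{l-1} (1 - q^{i+1})
poch : ℕ → Series
poch zero    = one
poch (suc l) = poch l ⊛ oneMinusQ^ (suc l)

-- Multiplicative inverse of a series a with constant term 1:
-- b₀ = 1, b_m = - Σ_{k=1}^{m} a_k b_{m-k}.
-- invRev a m = [b_m, b_{m-1}, …, b_0]
invRev : Series → ℕ → List ℤ
invRev a zero    = + 1 ∷ []
invRev a (suc m) = let bs = invRev a m in
  (- sumℤ (zipWith ℤ._*_ (map (λ j → a (suc j)) (upTo (suc m))) bs)) ∷ bs

inv : Series → Series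
inv a m with invRev a m
... | []    = + 0
... | b ∷ _ = b

-- Gaussian binomial [N+m ; n]_q = (q;q)_{n+m} / ((q;q)_n (q;q)_m)
gauss : ℕ → ℕ → Series
gauss n m = poch (n ℕ.+ m) ⊛ inv (poch n) ⊛ inv (poch m)

-- "f = Σ_{π ∈ S} q^{𝒪(π)}" as formal power series: for every n, the
-- coefficient f_n equals the (finite) number of π ∈ S with 𝒪(π) = n.

IsOGF : (List ℕ → Set) → Series → Set
IsOGF S f = (n : ℕ) → Σ ℕ λ c →
  (Fin c ↔ Σ (List ℕ) (λ π → S π × 𝒪 π ≡ n)) × (f n ≡ + c)

-- Write ℰ π = λ₂ + λ₄ + ⋯, so that 𝒪 (x ∷ r) = x + ℰ r and ℰ (x ∷ r) = 𝒪 r.  Removing the largest part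
-- of a partition whose parts are ≤ N+1 when it equals N+1 gives recurrences for the pairs of 𝒪- and
-- ℰ-generating functions:
--   Pₒ(N+1) = Pₒ N + q^(N+1) Pₑ(N+1),   Pₑ(N+1) = Pₑ N + Pₒ(N+1)   for 𝒫_{≤N},
--   Dₒ(N+1) = Dₒ N + q^(N+1) Dₑ N,      Dₑ(N+1) = Dₑ N + Dₒ N       for 𝒟_{≤N}.
-- Algebraically, let Pₒ N = Σ_{i+j=N} q^i / ((q)_i (q)_j) and Pₑ N = Σ_{i+j=N} 1 / ((q)_i (q)_j).
-- Splitting 1 - q^(i+j) = (1 - q^i) + q^i (1 - q^j) termwise gives
--   (1 - q^(N+1)) Pₒ(N+1) = Pₒ N + q^(N+1) Pₑ N   and   (1 - q^(N+1)) Pₑ(N+1) = Pₑ N + Pₒ N,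
-- which, 1 - q^(N+1) being cancellable, are equivalent to the first pair of recurrences; multiplying
-- by (q)_N gives the second pair for Dₒ N = (q)_N Pₒ N = Σ_i [N i] q^i and Dₑ N = (q)_N Pₑ N.

module Submission where

open import Algebra.Bundles using (CommutativeRing)
import Algebra.Solver.Ring as RingSolver
open import Algebra.Solver.Ring.AlmostCommutativeRing
  using (fromCommutativeRing; _-Raw-AlmostCommutative⟶_)
open import Data.Empty using (⊥-elim)
open import Data.Fin using (Fin)
open import Data.Fin.Properties using (+↔⊎)
open import Data.Integer as ℤ using (ℤ; +_; -_)
import Data.Integer.Properties as ℤP
open import Data.Integer.Tactic.RingSolver using (solve-∀)
open import Data.List using (List; []; _∷_; map; upTo; applyUpTo; zipWith)
open import Data.List.Properties using (map-upTo)
open import Data.List.Relation.Unary.All as All using (All; []; _∷_)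
open import Data.List.Relation.Unary.Linked as Linked using (Linked; []; [-]; _∷_)
open import Data.Maybe using (Maybe; just; nothing)
open import Data.Nat as ℕ using (ℕ; zero; suc; _∸_; _≤_; _<_; _≥_; z≤n; s≤s)
import Data.Nat.Properties as ℕP
open import Data.Nat.Induction using (<-rec)
open import Algebra.Construct.Pointwise ℕ using (isAbelianGroup)
open import Data.Product using (Σ; _×_; _,_; proj₁; proj₂)
open import Data.Sum using (_⊎_; inj₁; inj₂)
open import Data.Sum.Function.Propositional using (_⊎-↔_)
open import Function using (_∘_; _⟨_⟩_)
open import Function.Bundles using (_↔_; mk↔ₛ′)
open import Function.Properties.Inverse using (↔-trans; ↔-sym)
open import Level using (0ℓ)
open import Relation.Binary.PropositionalEquality
  using (_≡_; _≢_; refl; sym; trans; cong; cong₂; subst; _≗_; module ≡-Reasoning)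
import Relation.Binary.Reasoning.Setoid as SetoidReasoning
open import Relation.Nullary using (Dec; yes; no; ¬_)
open import Relation.Unary using (Irrelevant)
open import Defs

0ₛ : Series
0ₛ _ = + 0

-ₛ_ : Series → Series
(-ₛ f) n = - f n

_·_ : ℤ → Series → Series
(c · f) n = c ℤ.* f n

const : ℤ → Series
const c zero    = c
const c (suc _) = + 0

tail : Series → Series
tail f n = f (suc n)

⊛-suc : ∀ f g n → (f ⊛ g) (suc n) ≡ f 0 ℤ.* g (suc n) ℤ.+ (tail f ⊛ g) n
⊛-suc f g n = trans (cong sumℤ (map-upTo (λ k → f k ℤ.* g (suc n ∸ k)) (suc (suc n))))
  (cong (ℤ._+_ (f 0 ℤ.* g (suc n))) (sym (cong sumℤ (map-upTo (λ k → f (suc k) ℤ.* g (n ∸ k)) (suc n)))))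

⊛-cong : ∀ {f f′ g g′} → f ≗ f′ → g ≗ g′ → f ⊛ g ≗ f′ ⊛ g′
⊛-cong f≗f′ g≗g′ zero = cong₂ (λ a b → a ℤ.* b ℤ.+ + 0) (f≗f′ 0) (g≗g′ 0)
⊛-cong {f} {f′} {g} {g′} f≗f′ g≗g′ (suc n) = begin
  (f ⊛ g) (suc n)                            ≡⟨ ⊛-suc f g n ⟩
  f 0 ℤ.* g (suc n) ℤ.+ (tail f ⊛ g) n       ≡⟨ cong₂ ℤ._+_ (cong₂ ℤ._*_ (f≗f′ 0) (g≗g′ (suc n)))
                                                            (⊛-cong (f≗f′ ∘ suc) g≗g′ n) ⟩
  f′ 0 ℤ.* g′ (suc n) ℤ.+ (tail f′ ⊛ g′) n   ≡⟨ ⊛-suc f′ g′ n ⟨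
  (f′ ⊛ g′) (suc n)                          ∎
  where open ≡-Reasoning

⊛-congˡ : ∀ f {g g′} → g ≗ g′ → f ⊛ g ≗ f ⊛ g′
⊛-congˡ f = ⊛-cong {f} {f} (λ _ → refl)

⊛-congʳ : ∀ h {f f′} → f ≗ f′ → f ⊛ h ≗ f′ ⊛ h
⊛-congʳ h f≗f′ = ⊛-cong {g = h} {g′ = h} f≗f′ (λ _ → refl)

⊕-congˡ : ∀ f {g g′} → g ≗ g′ → f ⊕ g ≗ f ⊕ g′
⊕-congˡ f g≗g′ n = cong (ℤ._+_ (f n)) (g≗g′ n)

⊛-zeroˡ : ∀ f → 0ₛ ⊛ f ≗ 0ₛ
⊛-zeroˡ f zero    = cong (ℤ._+ + 0) (ℤP.*-zeroˡ (f 0))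
⊛-zeroˡ f (suc n) = trans (⊛-suc 0ₛ f n) (cong₂ ℤ._+_ (ℤP.*-zeroˡ (f (suc n))) (⊛-zeroˡ f n))

⊛-identityˡ : ∀ f → one ⊛ f ≗ f
⊛-identityˡ f zero    = trans (ℤP.+-identityʳ _) (ℤP.*-identityˡ (f 0))
⊛-identityˡ f (suc n) = begin
  (one ⊛ f) (suc n)                    ≡⟨ ⊛-suc one f n ⟩
  + 1 ℤ.* f (suc n) ℤ.+ (0ₛ ⊛ f) n     ≡⟨ cong₂ ℤ._+_ (ℤP.*-identityˡ (f (suc n))) (⊛-zeroˡ f n) ⟩
  f (suc n) ℤ.+ + 0                    ≡⟨ ℤP.+-identityʳ (f (suc n)) ⟩
  f (suc n)                            ∎
  where open ≡-Reasoning

⊛-distribʳ : ∀ h f g → (f ⊕ g) ⊛ h ≗ f ⊛ h ⊕ g ⊛ h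
⊛-distribʳ h f g zero = regroup (f 0) (g 0) (h 0)
  where regroup : ∀ a b c → (a ℤ.+ b) ℤ.* c ℤ.+ + 0 ≡ (a ℤ.* c ℤ.+ + 0) ℤ.+ (b ℤ.* c ℤ.+ + 0)
        regroup = solve-∀
⊛-distribʳ h f g (suc n) = begin
  ((f ⊕ g) ⊛ h) (suc n)
    ≡⟨ ⊛-suc (f ⊕ g) h n ⟩
  (f 0 ℤ.+ g 0) ℤ.* h (suc n) ℤ.+ ((tail f ⊕ tail g) ⊛ h) n
    ≡⟨ cong (ℤ._+_ ((f 0 ℤ.+ g 0) ℤ.* h (suc n))) (⊛-distribʳ h (tail f) (tail g) n) ⟩
  (f 0 ℤ.+ g 0) ℤ.* h (suc n) ℤ.+ ((tail f ⊛ h) n ℤ.+ (tail g ⊛ h) n)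
    ≡⟨ regroup (f 0) (g 0) (h (suc n)) _ _ ⟩
  (f 0 ℤ.* h (suc n) ℤ.+ (tail f ⊛ h) n) ℤ.+ (g 0 ℤ.* h (suc n) ℤ.+ (tail g ⊛ h) n)
    ≡⟨ cong₂ ℤ._+_ (⊛-suc f h n) (⊛-suc g h n) ⟨
  (f ⊛ h ⊕ g ⊛ h) (suc n) ∎
  where
  open ≡-Reasoning
  regroup : ∀ a b c x y → (a ℤ.+ b) ℤ.* c ℤ.+ (x ℤ.+ y) ≡ (a ℤ.* c ℤ.+ x) ℤ.+ (b ℤ.* c ℤ.+ y)
  regroup = solve-∀

·-⊛ : ∀ c f g → (c · f) ⊛ g ≗ c · (f ⊛ g)
·-⊛ c f g zero = regroup c (f 0) (g 0)
  where regroup : ∀ a b d → a ℤ.* b ℤ.* d ℤ.+ + 0 ≡ a ℤ.* (b ℤ.* d ℤ.+ + 0)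
        regroup = solve-∀
·-⊛ c f g (suc n) = begin
  ((c · f) ⊛ g) (suc n)                              ≡⟨ ⊛-suc (c · f) g n ⟩
  c ℤ.* f 0 ℤ.* g (suc n) ℤ.+ ((c · tail f) ⊛ g) n   ≡⟨ cong (ℤ._+_ (c ℤ.* f 0 ℤ.* g (suc n)))
                                                               (·-⊛ c (tail f) g n) ⟩
  c ℤ.* f 0 ℤ.* g (suc n) ℤ.+ c ℤ.* (tail f ⊛ g) n   ≡⟨ regroup c (f 0) (g (suc n)) _ ⟩
  c ℤ.* (f 0 ℤ.* g (suc n) ℤ.+ (tail f ⊛ g) n)       ≡⟨ cong (c ℤ.*_) (⊛-suc f g n) ⟨
  (c · (f ⊛ g)) (suc n)                              ∎
  where
  open ≡-Reasoning
  regroup : ∀ a b d x → a ℤ.* b ℤ.* d ℤ.+ a ℤ.* x ≡ a ℤ.* (b ℤ.* d ℤ.+ x)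
  regroup = solve-∀

⊛-assoc : ∀ f g h → (f ⊛ g) ⊛ h ≗ f ⊛ (g ⊛ h)
⊛-assoc f g h zero = regroup (f 0) (g 0) (h 0)
  where regroup : ∀ a b c → (a ℤ.* b ℤ.+ + 0) ℤ.* c ℤ.+ + 0 ≡ a ℤ.* (b ℤ.* c ℤ.+ + 0) ℤ.+ + 0
        regroup = solve-∀
⊛-assoc f g h (suc n) = begin
  ((f ⊛ g) ⊛ h) (suc n)
    ≡⟨ ⊛-suc (f ⊛ g) h n ⟩
  c ℤ.* h (suc n) ℤ.+ (tail (f ⊛ g) ⊛ h) n
    ≡⟨ cong (ℤ._+_ (c ℤ.* h (suc n))) (⊛-congʳ h (⊛-suc f g) n) ⟩
  c ℤ.* h (suc n) ℤ.+ ((f 0 · tail g ⊕ tail f ⊛ g) ⊛ h) n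
    ≡⟨ cong (ℤ._+_ (c ℤ.* h (suc n))) (⊛-distribʳ h (f 0 · tail g) (tail f ⊛ g) n) ⟩
  c ℤ.* h (suc n) ℤ.+ (((f 0 · tail g) ⊛ h) n ℤ.+ ((tail f ⊛ g) ⊛ h) n)
    ≡⟨ cong (ℤ._+_ (c ℤ.* h (suc n)))
            (cong₂ ℤ._+_ (·-⊛ (f 0) (tail g) h n) (⊛-assoc (tail f) g h n)) ⟩
  c ℤ.* h (suc n) ℤ.+ (f 0 ℤ.* (tail g ⊛ h) n ℤ.+ (tail f ⊛ (g ⊛ h)) n)
    ≡⟨ regroup (f 0) (g 0) (h (suc n)) _ _ ⟩
  f 0 ℤ.* (g 0 ℤ.* h (suc n) ℤ.+ (tail g ⊛ h) n) ℤ.+ (tail f ⊛ (g ⊛ h)) n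
    ≡⟨ cong (λ z → f 0 ℤ.* z ℤ.+ (tail f ⊛ (g ⊛ h)) n) (⊛-suc g h n) ⟨
  f 0 ℤ.* (g ⊛ h) (suc n) ℤ.+ (tail f ⊛ (g ⊛ h)) n
    ≡⟨ ⊛-suc f (g ⊛ h) n ⟨
  (f ⊛ (g ⊛ h)) (suc n) ∎
  where
  open ≡-Reasoning
  c = f 0 ℤ.* g 0 ℤ.+ + 0
  regroup : ∀ a b d x y → (a ℤ.* b ℤ.+ + 0) ℤ.* d ℤ.+ (a ℤ.* x ℤ.+ y) ≡ a ℤ.* (b ℤ.* d ℤ.+ x) ℤ.+ y
  regroup = solve-∀

-- Two-step induction: unfolding f ⊛ g and g ⊛ f twice meets at tail f ⊛ tail g two degrees lower.
⊛-comm-at : ∀ n → (∀ f g → (f ⊛ g) n ≡ (g ⊛ f) n) × (∀ f g → (f ⊛ g) (suc n) ≡ (g ⊛ f) (suc n))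
⊛-comm-at zero = (λ f g → cong (ℤ._+ + 0) (ℤP.*-comm (f 0) (g 0)))
               , (λ f g → regroup (f 0) (f 1) (g 0) (g 1))
  where regroup : ∀ a b c d → a ℤ.* d ℤ.+ (b ℤ.* c ℤ.+ + 0) ≡ c ℤ.* b ℤ.+ (d ℤ.* a ℤ.+ + 0)
        regroup = solve-∀
⊛-comm-at (suc n) = comm₁ , comm₂
  where
  comm₀ = proj₁ (⊛-comm-at n)
  comm₁ = proj₂ (⊛-comm-at n)
  comm₂ : ∀ f g → (f ⊛ g) (2 ℕ.+ n) ≡ (g ⊛ f) (2 ℕ.+ n)
  comm₂ f g = begin
    (f ⊛ g) (2 ℕ.+ n)
      ≡⟨ ⊛-suc f g (suc n) ⟩
    a ℤ.+ (tail f ⊛ g) (suc n)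
      ≡⟨ cong (ℤ._+_ a) (trans (comm₁ (tail f) g) (⊛-suc g (tail f) n)) ⟩
    a ℤ.+ (b ℤ.+ (tail g ⊛ tail f) n)
      ≡⟨ cong (λ z → a ℤ.+ (b ℤ.+ z)) (comm₀ (tail g) (tail f)) ⟩
    a ℤ.+ (b ℤ.+ (tail f ⊛ tail g) n)
      ≡⟨ regroup a b _ ⟩
    b ℤ.+ (a ℤ.+ (tail f ⊛ tail g) n)
      ≡⟨ cong (ℤ._+_ b) (trans (comm₁ (tail g) f) (⊛-suc f (tail g) n)) ⟨
    b ℤ.+ (tail g ⊛ f) (suc n)
      ≡⟨ ⊛-suc g f (suc n) ⟨
    (g ⊛ f) (2 ℕ.+ n) ∎
    where
    open ≡-Reasoning
    a = f 0 ℤ.* g (2 ℕ.+ n)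
    b = g 0 ℤ.* f (2 ℕ.+ n)
    regroup : ∀ x y z → x ℤ.+ (y ℤ.+ z) ≡ y ℤ.+ (x ℤ.+ z)
    regroup = solve-∀

⊛-comm : ∀ f g → f ⊛ g ≗ g ⊛ f
⊛-comm f g n = proj₁ (⊛-comm-at n) f g

⊛-distribˡ : ∀ h f g → h ⊛ (f ⊕ g) ≗ h ⊛ f ⊕ h ⊛ g
⊛-distribˡ h f g n = begin
  (h ⊛ (f ⊕ g)) n          ≡⟨ ⊛-comm h (f ⊕ g) n ⟩
  ((f ⊕ g) ⊛ h) n          ≡⟨ ⊛-distribʳ h f g n ⟩
  (f ⊛ h ⊕ g ⊛ h) n        ≡⟨ cong₂ ℤ._+_ (⊛-comm f h n) (⊛-comm g h n) ⟩
  (h ⊛ f ⊕ h ⊛ g) n        ∎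
  where open ≡-Reasoning

⊛-zeroʳ : ∀ f → f ⊛ 0ₛ ≗ 0ₛ
⊛-zeroʳ f n = trans (⊛-comm f 0ₛ n) (⊛-zeroˡ f n)

⊛-identityʳ : ∀ f → f ⊛ one ≗ f
⊛-identityʳ f n = trans (⊛-comm f one n) (⊛-identityˡ f n)

seriesRing : CommutativeRing 0ℓ 0ℓ
seriesRing = record
  { Carrier = Series ; _≈_ = _≗_ ; _+_ = _⊕_ ; _*_ = _⊛_ ; -_ = -ₛ_ ; 0# = 0ₛ ; 1# = one
  ; isCommutativeRing = record
    { isRing = record
      { +-isAbelianGroup = isAbelianGroup ℤP.+-0-isAbelianGroup
      ; *-cong = ⊛-cong
      ; *-assoc = ⊛-assoc
      ; *-identity = ⊛-identityˡ , ⊛-identityʳ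
      ; distrib = ⊛-distribˡ , ⊛-distribʳ
      }
    ; *-comm = ⊛-comm
    }
  }

open CommutativeRing seriesRing using (setoid; +-cong) renaming (sym to ≗-sym; trans to ≗-trans)

module ≗-Reasoning = SetoidReasoning setoid

const-* : ∀ a b → const (a ℤ.* b) ≗ const a ⊛ const b
const-* a b zero    = sym (ℤP.+-identityʳ (a ℤ.* b))
const-* a b (suc n) = sym (trans (⊛-suc (const a) (const b) n)
                                 (cong₂ ℤ._+_ (ℤP.*-zeroʳ a) (⊛-zeroˡ (const b) n)))

constHom : ℤ.+-*-rawRing -Raw-AlmostCommutative⟶ fromCommutativeRing seriesRing
constHom = record
  { ⟦_⟧    = const
  ; +-homo = λ { a b zero → refl ; a b (suc n) → refl }
  ; *-homo = const-*
  ; -‿homo = λ { a zero → refl ; a (suc n) → refl }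
  ; 0-homo = λ { zero → refl ; (suc n) → refl }
  ; 1-homo = λ { zero → refl ; (suc n) → refl }
  }

const≟ : ∀ a b → Maybe (const a ≗ const b)
const≟ a b with a ℤ.≟ b
... | yes refl = just (λ _ → refl)
... | no _     = nothing

open RingSolver ℤ.+-*-rawRing (fromCommutativeRing seriesRing) constHom const≟
  using (solve; con; _:+_; _:-_; _:*_; _:=_)

qpow-diag : ∀ i → qpow i i ≡ + 1
qpow-diag i with i ℕ.≟ i
... | yes _   = refl
... | no i≢i  = ⊥-elim (i≢i refl)

qpow-off : ∀ {i n} → i ≢ n → qpow i n ≡ + 0
qpow-off {i} {n} i≢n with i ℕ.≟ n
... | yes i≡n = ⊥-elim (i≢n i≡n)
... | no _    = refl

qpow-zero : qpow 0 ≗ one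
qpow-zero zero    = refl
qpow-zero (suc n) = refl

qpow-suc : ∀ i n → qpow (suc i) (suc n) ≡ qpow i n
qpow-suc i n = by-cases (i ℕ.≟ n)
  where
  by-cases : Dec (i ≡ n) → qpow (suc i) (suc n) ≡ qpow i n
  by-cases (yes refl) = trans (qpow-diag (suc i)) (sym (qpow-diag i))
  by-cases (no i≢n)   = trans (qpow-off (i≢n ∘ ℕP.suc-injective)) (sym (qpow-off i≢n))

shift : ℕ → Series → Series
shift zero    f         = f
shift (suc k) f zero    = + 0
shift (suc k) f (suc n) = shift k f n

qpow-⊛ : ∀ k f → qpow k ⊛ f ≗ shift k f
qpow-⊛ zero    f n       = trans (⊛-congʳ f qpow-zero n) (⊛-identityˡ f n)
qpow-⊛ (suc k) f zero    = cong (ℤ._+ + 0) (ℤP.*-zeroˡ (f 0))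
qpow-⊛ (suc k) f (suc n) = begin
  (qpow (suc k) ⊛ f) (suc n)                          ≡⟨ ⊛-suc (qpow (suc k)) f n ⟩
  + 0 ℤ.* f (suc n) ℤ.+ (tail (qpow (suc k)) ⊛ f) n   ≡⟨ cong₂ ℤ._+_ (ℤP.*-zeroˡ (f (suc n)))
                                                                     (⊛-congʳ f (qpow-suc k) n) ⟩
  + 0 ℤ.+ (qpow k ⊛ f) n                              ≡⟨ ℤP.+-identityˡ _ ⟩
  (qpow k ⊛ f) n                                      ≡⟨ qpow-⊛ k f n ⟩
  shift k f n                                         ∎
  where open ≡-Reasoning

shift-qpow : ∀ i j → shift i (qpow j) ≗ qpow (i ℕ.+ j)
shift-qpow zero    j n       = refl
shift-qpow (suc i) j zero    = refl
shift-qpow (suc i) j (suc n) = trans (shift-qpow i j n) (sym (qpow-suc (i ℕ.+ j) n))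

qpow-+ : ∀ i j → qpow (i ℕ.+ j) ≗ qpow i ⊛ qpow j
qpow-+ i j n = sym (trans (qpow-⊛ i (qpow j) n) (shift-qpow i j n))

zipWith-applyUpTo : ∀ {A B C : Set} (_∙_ : A → B → C) f g n →
  zipWith _∙_ (applyUpTo f n) (applyUpTo g n) ≡ applyUpTo (λ k → f k ∙ g k) n
zipWith-applyUpTo _∙_ f g zero    = refl
zipWith-applyUpTo _∙_ f g (suc n) = cong (f 0 ∙ g 0 ∷_) (zipWith-applyUpTo _∙_ (f ∘ suc) (g ∘ suc) n)

invRev-applyUpTo : ∀ a m → invRev a m ≡ applyUpTo (λ k → inv a (m ∸ k)) (suc m)
invRev-applyUpTo a zero    = refl
invRev-applyUpTo a (suc m) = cong (inv a (suc m) ∷_) (invRev-applyUpTo a m)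

inv-suc : ∀ a m → inv a (suc m) ≡ - (tail a ⊛ inv a) m
inv-suc a m = cong (λ xs → - sumℤ xs) (begin
  zipWith ℤ._*_ (map (tail a) (upTo (suc m))) (invRev a m)
    ≡⟨ cong₂ (zipWith ℤ._*_) (map-upTo (tail a) (suc m)) (invRev-applyUpTo a m) ⟩
  zipWith ℤ._*_ (applyUpTo (tail a) (suc m)) (applyUpTo (λ k → inv a (m ∸ k)) (suc m))
    ≡⟨ zipWith-applyUpTo ℤ._*_ (tail a) (λ k → inv a (m ∸ k)) (suc m) ⟩
  applyUpTo (λ k → a (suc k) ℤ.* inv a (m ∸ k)) (suc m)
    ≡⟨ map-upTo (λ k → a (suc k) ℤ.* inv a (m ∸ k)) (suc m) ⟨
  map (λ k → a (suc k) ℤ.* inv a (m ∸ k)) (upTo (suc m)) ∎)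
  where open ≡-Reasoning

⊛-inverseʳ : ∀ a → a 0 ≡ + 1 → a ⊛ inv a ≗ one
⊛-inverseʳ a a₀≡1 zero rewrite a₀≡1 = refl
⊛-inverseʳ a a₀≡1 (suc m) = begin
  (a ⊛ inv a) (suc m)                           ≡⟨ ⊛-suc a (inv a) m ⟩
  a 0 ℤ.* inv a (suc m) ℤ.+ s                   ≡⟨ cong₂ (λ x y → x ℤ.* y ℤ.+ s) a₀≡1 (inv-suc a m) ⟩
  + 1 ℤ.* - s ℤ.+ s                             ≡⟨ cong (ℤ._+ s) (ℤP.*-identityˡ (- s)) ⟩
  - s ℤ.+ s                                     ≡⟨ ℤP.+-inverseˡ s ⟩
  + 0                                           ∎
  where
  open ≡-Reasoning
  s = (tail a ⊛ inv a) m

⊛-inverseˡ : ∀ a → a 0 ≡ + 1 → inv a ⊛ a ≗ one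
⊛-inverseˡ a a₀≡1 n = trans (⊛-comm (inv a) a n) (⊛-inverseʳ a a₀≡1 n)

⊛-cancelˡ : ∀ a → a 0 ≡ + 1 → ∀ f g → a ⊛ f ≗ a ⊛ g → f ≗ g
⊛-cancelˡ a a₀≡1 f g af≗ag = begin
  f                  ≈⟨ ⊛-identityˡ f ⟨
  one ⊛ f            ≈⟨ ⊛-congʳ f (⊛-inverseˡ a a₀≡1) ⟨
  (inv a ⊛ a) ⊛ f    ≈⟨ ⊛-assoc (inv a) a f ⟩
  inv a ⊛ (a ⊛ f)    ≈⟨ ⊛-congˡ (inv a) af≗ag ⟩
  inv a ⊛ (a ⊛ g)    ≈⟨ ⊛-assoc (inv a) a g ⟨
  (inv a ⊛ a) ⊛ g    ≈⟨ ⊛-congʳ g (⊛-inverseˡ a a₀≡1) ⟩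
  one ⊛ g            ≈⟨ ⊛-identityˡ g ⟩
  g                  ∎
  where open ≗-Reasoning

inv-unique : ∀ a c → a 0 ≡ + 1 → c ⊛ a ≗ one → c ≗ inv a
inv-unique a c a₀≡1 ca≗1 = ⊛-cancelˡ a a₀≡1 c (inv a) (λ n → begin
  (a ⊛ c) n     ≡⟨ ⊛-comm a c n ⟩
  (c ⊛ a) n     ≡⟨ ca≗1 n ⟩
  one n         ≡⟨ ⊛-inverseʳ a a₀≡1 n ⟨
  (a ⊛ inv a) n ∎)
  where open ≡-Reasoning

⊛-constant : ∀ a b → a 0 ≡ + 1 → b 0 ≡ + 1 → (a ⊛ b) 0 ≡ + 1
⊛-constant a b a₀≡1 b₀≡1 rewrite a₀≡1 | b₀≡1 = refl

oneMinusQ^≗ : ∀ k → oneMinusQ^ k ≗ const (+ 1) ⊕ -ₛ qpow k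
oneMinusQ^≗ k zero    = refl
oneMinusQ^≗ k (suc n) = refl

oneMinusQ^-zero : oneMinusQ^ 0 ≗ 0ₛ
oneMinusQ^-zero zero    = refl
oneMinusQ^-zero (suc n) = refl

oneMinusQ^-+ : ∀ i j → oneMinusQ^ (i ℕ.+ j) ≗ const (+ 1) ⊕ -ₛ (qpow i ⊛ qpow j)
oneMinusQ^-+ i j n = trans (oneMinusQ^≗ (i ℕ.+ j) n) (cong (λ x → const (+ 1) n ℤ.+ - x) (qpow-+ i j n))

split-oneMinusQ^ : ∀ i j W → oneMinusQ^ (i ℕ.+ j) ⊛ W ≗ oneMinusQ^ i ⊛ W ⊕ qpow i ⊛ (oneMinusQ^ j ⊛ W)
split-oneMinusQ^ i j W = begin
  oneMinusQ^ (i ℕ.+ j) ⊛ W                                 ≈⟨ ⊛-congʳ W (oneMinusQ^-+ i j) ⟩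
  (1ₛ ⊕ -ₛ (qpow i ⊛ qpow j)) ⊛ W                          ≈⟨ identity (qpow i) (qpow j) W ⟩
  (1ₛ ⊕ -ₛ qpow i) ⊛ W ⊕ qpow i ⊛ ((1ₛ ⊕ -ₛ qpow j) ⊛ W)
    ≈⟨ +-cong (⊛-congʳ W (oneMinusQ^≗ i)) (⊛-congˡ (qpow i) (⊛-congʳ W (oneMinusQ^≗ j))) ⟨
  oneMinusQ^ i ⊛ W ⊕ qpow i ⊛ (oneMinusQ^ j ⊛ W)           ∎
  where
  open ≗-Reasoning
  1ₛ = const (+ 1)
  identity : ∀ P Q W → (1ₛ ⊕ -ₛ (P ⊛ Q)) ⊛ W ≗ (1ₛ ⊕ -ₛ P) ⊛ W ⊕ P ⊛ ((1ₛ ⊕ -ₛ Q) ⊛ W)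
  identity = solve 3 (λ P Q W → (con (+ 1) :- P :* Q) :* W
                                := (con (+ 1) :- P) :* W :+ P :* ((con (+ 1) :- Q) :* W))
                     (λ _ → refl)

split-oneMinusQ^-qpow : ∀ i j W →
  oneMinusQ^ (i ℕ.+ j) ⊛ (qpow i ⊛ W) ≗ qpow i ⊛ (oneMinusQ^ j ⊛ W) ⊕ qpow (i ℕ.+ j) ⊛ (oneMinusQ^ i ⊛ W)
split-oneMinusQ^-qpow i j W = begin
  oneMinusQ^ (i ℕ.+ j) ⊛ (qpow i ⊛ W)
    ≈⟨ ⊛-congʳ (qpow i ⊛ W) (oneMinusQ^-+ i j) ⟩
  (1ₛ ⊕ -ₛ (qpow i ⊛ qpow j)) ⊛ (qpow i ⊛ W)
    ≈⟨ identity (qpow i) (qpow j) W ⟩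
  qpow i ⊛ ((1ₛ ⊕ -ₛ qpow j) ⊛ W) ⊕ (qpow i ⊛ qpow j) ⊛ ((1ₛ ⊕ -ₛ qpow i) ⊛ W)
    ≈⟨ +-cong (⊛-congˡ (qpow i) (⊛-congʳ W (oneMinusQ^≗ j)))
              (⊛-cong (qpow-+ i j) (⊛-congʳ W (oneMinusQ^≗ i))) ⟨
  qpow i ⊛ (oneMinusQ^ j ⊛ W) ⊕ qpow (i ℕ.+ j) ⊛ (oneMinusQ^ i ⊛ W)
    ∎
  where
  open ≗-Reasoning
  1ₛ = const (+ 1)
  identity : ∀ P Q W →
    (1ₛ ⊕ -ₛ (P ⊛ Q)) ⊛ (P ⊛ W) ≗ P ⊛ ((1ₛ ⊕ -ₛ Q) ⊛ W) ⊕ (P ⊛ Q) ⊛ ((1ₛ ⊕ -ₛ P) ⊛ W)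
  identity = solve 3 (λ P Q W → (con (+ 1) :- P :* Q) :* (P :* W)
                                := P :* ((con (+ 1) :- Q) :* W) :+ (P :* Q) :* ((con (+ 1) :- P) :* W))
                     (λ _ → refl)

oneMinusQ^-system : ∀ k X Y X′ Y′ →
  oneMinusQ^ (suc k) ⊛ X ≗ X′ ⊕ qpow (suc k) ⊛ Y′ → oneMinusQ^ (suc k) ⊛ Y ≗ Y′ ⊕ X′ →
  (Y ≗ Y′ ⊕ X) × (X ≗ X′ ⊕ qpow (suc k) ⊛ Y)
oneMinusQ^-system k X Y X′ Y′ aX≗ aY≗ = Y≗ , X≗
  where
  open ≗-Reasoning
  a = oneMinusQ^ (suc k)
  q = qpow (suc k)
  1ₛ = const (+ 1)
  a₀≡1 : a 0 ≡ + 1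
  a₀≡1 = refl
  identityY : ∀ q X′ Y′ → (1ₛ ⊕ -ₛ q) ⊛ Y′ ⊕ (X′ ⊕ q ⊛ Y′) ≗ Y′ ⊕ X′
  identityY = solve 3 (λ q X′ Y′ → (con (+ 1) :- q) :* Y′ :+ (X′ :+ q :* Y′) := Y′ :+ X′) (λ _ → refl)
  identityX : ∀ q X′ Y′ → X′ ⊕ q ⊛ Y′ ≗ (1ₛ ⊕ -ₛ q) ⊛ X′ ⊕ q ⊛ (Y′ ⊕ X′)
  identityX = solve 3 (λ q X′ Y′ → X′ :+ q :* Y′ := (con (+ 1) :- q) :* X′ :+ q :* (Y′ :+ X′)) (λ _ → refl)
  factor : ∀ a q X′ Y → a ⊛ X′ ⊕ q ⊛ (a ⊛ Y) ≗ a ⊛ (X′ ⊕ q ⊛ Y)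
  factor = solve 4 (λ a q X′ Y → a :* X′ :+ q :* (a :* Y) := a :* (X′ :+ q :* Y)) (λ _ → refl)
  Y≗ : Y ≗ Y′ ⊕ X
  Y≗ = ⊛-cancelˡ a a₀≡1 Y (Y′ ⊕ X) (begin
    a ⊛ Y                                  ≈⟨ aY≗ ⟩
    Y′ ⊕ X′                                ≈⟨ identityY q X′ Y′ ⟨
    (1ₛ ⊕ -ₛ q) ⊛ Y′ ⊕ (X′ ⊕ q ⊛ Y′)       ≈⟨ +-cong (⊛-congʳ Y′ (oneMinusQ^≗ (suc k))) aX≗ ⟨
    a ⊛ Y′ ⊕ a ⊛ X                         ≈⟨ ⊛-distribˡ a Y′ X ⟨
    a ⊛ (Y′ ⊕ X)                           ∎)
  X≗ : X ≗ X′ ⊕ q ⊛ Y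
  X≗ = ⊛-cancelˡ a a₀≡1 X (X′ ⊕ q ⊛ Y) (begin
    a ⊛ X                                  ≈⟨ aX≗ ⟩
    X′ ⊕ q ⊛ Y′                            ≈⟨ identityX q X′ Y′ ⟩
    (1ₛ ⊕ -ₛ q) ⊛ X′ ⊕ q ⊛ (Y′ ⊕ X′)       ≈⟨ +-cong (⊛-congʳ X′ (oneMinusQ^≗ (suc k))) (⊛-congˡ q aY≗) ⟨
    a ⊛ X′ ⊕ q ⊛ (a ⊛ Y)                   ≈⟨ factor a q X′ Y ⟩
    a ⊛ (X′ ⊕ q ⊛ Y)                       ∎)

poch-constant : ∀ l → poch l 0 ≡ + 1
poch-constant zero    = refl
poch-constant (suc l) rewrite poch-constant l = refl

pochInv : ℕ → ℕ → Series
pochInv i j = inv (poch i ⊛ poch j)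

pochPair-constant : ∀ i j → (poch i ⊛ poch j) 0 ≡ + 1
pochPair-constant i j = ⊛-constant (poch i) (poch j) (poch-constant i) (poch-constant j)

pochInv-inverse : ∀ i j → pochInv i j ⊛ (poch i ⊛ poch j) ≗ one
pochInv-inverse i j = ⊛-inverseˡ (poch i ⊛ poch j) (pochPair-constant i j)

pochInv-sucˡ : ∀ i j → oneMinusQ^ (suc i) ⊛ pochInv (suc i) j ≗ pochInv i j
pochInv-sucˡ i j = inv-unique (poch i ⊛ poch j) _ (pochPair-constant i j) (begin
  (a ⊛ pochInv (suc i) j) ⊛ (poch i ⊛ poch j)   ≈⟨ rearrange a (pochInv (suc i) j) (poch i) (poch j) ⟩
  pochInv (suc i) j ⊛ ((poch i ⊛ a) ⊛ poch j)   ≈⟨ pochInv-inverse (suc i) j ⟩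
  one                                            ∎)
  where
  open ≗-Reasoning
  a = oneMinusQ^ (suc i)
  rearrange : ∀ a x p r → (a ⊛ x) ⊛ (p ⊛ r) ≗ x ⊛ ((p ⊛ a) ⊛ r)
  rearrange = solve 4 (λ a x p r → (a :* x) :* (p :* r) := x :* ((p :* a) :* r)) (λ _ → refl)

pochInv-sucʳ : ∀ i j → oneMinusQ^ (suc j) ⊛ pochInv i (suc j) ≗ pochInv i j
pochInv-sucʳ i j = inv-unique (poch i ⊛ poch j) _ (pochPair-constant i j) (begin
  (a ⊛ pochInv i (suc j)) ⊛ (poch i ⊛ poch j)   ≈⟨ rearrange a (pochInv i (suc j)) (poch i) (poch j) ⟩
  pochInv i (suc j) ⊛ (poch i ⊛ (poch j ⊛ a))   ≈⟨ pochInv-inverse i (suc j) ⟩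
  one                                            ∎)
  where
  open ≗-Reasoning
  a = oneMinusQ^ (suc j)
  rearrange : ∀ a x p r → (a ⊛ x) ⊛ (p ⊛ r) ≗ x ⊛ (p ⊛ (r ⊛ a))
  rearrange = solve 4 (λ a x p r → (a :* x) :* (p :* r) := x :* (p :* (r :* a))) (λ _ → refl)

pochInv-zero : pochInv 0 0 ≗ one
pochInv-zero = ≗-sym (inv-unique (one ⊛ one) one refl (⊛-identityˡ (one ⊛ one) ⟨ ≗-trans ⟩ ⊛-identityˡ one))

inv-⊛ : ∀ a b → a 0 ≡ + 1 → b 0 ≡ + 1 → inv a ⊛ inv b ≗ inv (a ⊛ b)
inv-⊛ a b a₀≡1 b₀≡1 = inv-unique (a ⊛ b) (inv a ⊛ inv b) (⊛-constant a b a₀≡1 b₀≡1) (begin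
  (inv a ⊛ inv b) ⊛ (a ⊛ b)    ≈⟨ rearrange (inv a) (inv b) a b ⟩
  (inv a ⊛ a) ⊛ (inv b ⊛ b)    ≈⟨ ⊛-cong (⊛-inverseˡ a a₀≡1) (⊛-inverseˡ b b₀≡1) ⟩
  one ⊛ one                    ≈⟨ ⊛-identityˡ one ⟩
  one                          ∎)
  where
  open ≗-Reasoning
  rearrange : ∀ x y a b → (x ⊛ y) ⊛ (a ⊛ b) ≗ (x ⊛ a) ⊛ (y ⊛ b)
  rearrange = solve 4 (λ x y a b → (x :* y) :* (a :* b) := (x :* a) :* (y :* b)) (λ _ → refl)

gauss≗ : ∀ i j → gauss i j ≗ poch (i ℕ.+ j) ⊛ pochInv i j
gauss≗ i j = ⊛-assoc (poch (i ℕ.+ j)) (inv (poch i)) (inv (poch j))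
  ⟨ ≗-trans ⟩ ⊛-congˡ (poch (i ℕ.+ j)) (inv-⊛ (poch i) (poch j) (poch-constant i) (poch-constant j))

antidiagonal : ℕ → (ℕ → ℕ → Series) → Series
antidiagonal zero    h = h 0 0
antidiagonal (suc N) h = h 0 (suc N) ⊕ antidiagonal N (λ i j → h (suc i) j)

sumTo-antidiagonal : ∀ N (h : ℕ → ℕ → Series) → sumTo N (λ i → h i (N ∸ i)) ≗ antidiagonal N h
sumTo-antidiagonal N h n = trans (cong sumℤ (map-upTo (λ i → h i (N ∸ i) n) (suc N))) (unfold N h)
  where
  unfold : ∀ N h → sumℤ (applyUpTo (λ i → h i (N ∸ i) n) (suc N)) ≡ antidiagonal N h n
  unfold zero    h = ℤP.+-identityʳ (h 0 0 n)
  unfold (suc N) h = cong (ℤ._+_ (h 0 (suc N) n)) (unfold N (λ i j → h (suc i) j))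

antidiagonal-cong : ∀ N {f g} → (∀ i j → f i j ≗ g i j) → antidiagonal N f ≗ antidiagonal N g
antidiagonal-cong zero    f≗g = f≗g 0 0
antidiagonal-cong (suc N) f≗g = +-cong (f≗g 0 (suc N)) (antidiagonal-cong N (λ i j → f≗g (suc i) j))

antidiagonal-⊕ : ∀ N (f g : ℕ → ℕ → Series) →
  antidiagonal N (λ i j → f i j ⊕ g i j) ≗ antidiagonal N f ⊕ antidiagonal N g
antidiagonal-⊕ zero    f g n = refl
antidiagonal-⊕ (suc N) f g n =
  trans (cong (ℤ._+_ (f 0 (suc N) n ℤ.+ g 0 (suc N) n))
              (antidiagonal-⊕ N (λ i j → f (suc i) j) (λ i j → g (suc i) j) n))
        (regroup (f 0 (suc N) n) (g 0 (suc N) n) _ _)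
  where regroup : ∀ a b c d → (a ℤ.+ b) ℤ.+ (c ℤ.+ d) ≡ (a ℤ.+ c) ℤ.+ (b ℤ.+ d)
        regroup = solve-∀

antidiagonal-⊛ : ∀ N (c : ℕ → Series) (f : ℕ → ℕ → Series) →
  antidiagonal N (λ i j → c (i ℕ.+ j) ⊛ f i j) ≗ c N ⊛ antidiagonal N f
antidiagonal-⊛ zero    c f = λ _ → refl
antidiagonal-⊛ (suc N) c f =
  ⊕-congˡ (c (suc N) ⊛ f 0 (suc N)) (antidiagonal-⊛ N (c ∘ suc) (λ i j → f (suc i) j))
  ⟨ ≗-trans ⟩ ≗-sym (⊛-distribˡ (c (suc N)) (f 0 (suc N)) (antidiagonal N (λ i j → f (suc i) j)))

antidiagonal-sucʳ : ∀ N (h : ℕ → ℕ → Series) →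
  antidiagonal (suc N) h ≗ antidiagonal N (λ i j → h i (suc j)) ⊕ h (suc N) 0
antidiagonal-sucʳ zero    h n = refl
antidiagonal-sucʳ (suc N) h n =
  trans (cong (ℤ._+_ (h 0 (2 ℕ.+ N) n)) (antidiagonal-sucʳ N (λ i j → h (suc i) j) n))
        (sym (ℤP.+-assoc (h 0 (2 ℕ.+ N) n) _ _))

antidiagonal-dropˡ : ∀ N (h : ℕ → ℕ → Series) → h 0 (suc N) ≗ 0ₛ →
  antidiagonal (suc N) h ≗ antidiagonal N (λ i j → h (suc i) j)
antidiagonal-dropˡ N h h≗0 n =
  trans (cong (ℤ._+ antidiagonal N (λ i j → h (suc i) j) n) (h≗0 n)) (ℤP.+-identityˡ _)

antidiagonal-dropʳ : ∀ N (h : ℕ → ℕ → Series) → h (suc N) 0 ≗ 0ₛ →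
  antidiagonal (suc N) h ≗ antidiagonal N (λ i j → h i (suc j))
antidiagonal-dropʳ N h h≗0 n =
  trans (antidiagonal-sucʳ N h n)
        (trans (cong (ℤ._+_ (antidiagonal N (λ i j → h i (suc j)) n)) (h≗0 n)) (ℤP.+-identityʳ _))

oneMinusQ^-zero-⊛ : ∀ f → oneMinusQ^ 0 ⊛ f ≗ 0ₛ
oneMinusQ^-zero-⊛ f = ⊛-congʳ f oneMinusQ^-zero ⟨ ≗-trans ⟩ ⊛-zeroˡ f

⊛-oneMinusQ^-zero-⊛ : ∀ f g → f ⊛ (oneMinusQ^ 0 ⊛ g) ≗ 0ₛ
⊛-oneMinusQ^-zero-⊛ f g = ⊛-congˡ f (oneMinusQ^-zero-⊛ g) ⟨ ≗-trans ⟩ ⊛-zeroʳ f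

Pₒ Pₑ Dₒ Dₑ : ℕ → Series
Pₒ N = antidiagonal N (λ i j → qpow i ⊛ pochInv i j)
Pₑ N = antidiagonal N pochInv
Dₒ N = poch N ⊛ Pₒ N
Dₑ N = poch N ⊛ Pₑ N

Pₒ-step : ∀ N → oneMinusQ^ (suc N) ⊛ Pₒ (suc N) ≗ Pₒ N ⊕ qpow (suc N) ⊛ Pₑ N
Pₒ-step N = begin
  oneMinusQ^ (suc N) ⊛ Pₒ (suc N)
    ≈⟨ antidiagonal-⊛ (suc N) oneMinusQ^ (λ i j → qpow i ⊛ pochInv i j) ⟨
  antidiagonal (suc N) (λ i j → oneMinusQ^ (i ℕ.+ j) ⊛ (qpow i ⊛ pochInv i j))
    ≈⟨ antidiagonal-cong (suc N) (λ i j → split-oneMinusQ^-qpow i j (pochInv i j)) ⟩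
  antidiagonal (suc N) (λ i j → A i j ⊕ B i j)
    ≈⟨ antidiagonal-⊕ (suc N) A B ⟩
  antidiagonal (suc N) A ⊕ antidiagonal (suc N) B
    ≈⟨ +-cong (antidiagonal-dropʳ N A (⊛-oneMinusQ^-zero-⊛ (qpow (suc N)) (pochInv (suc N) 0)))
              (antidiagonal-dropˡ N B (⊛-oneMinusQ^-zero-⊛ (qpow (suc N)) (pochInv 0 (suc N)))) ⟩
  antidiagonal N (λ i j → A i (suc j)) ⊕ antidiagonal N (λ i j → B (suc i) j)
    ≈⟨ +-cong (antidiagonal-cong N (λ i j → ⊛-congˡ (qpow i) (pochInv-sucʳ i j)))
              (antidiagonal-cong N (λ i j → ⊛-congˡ (qpow (suc (i ℕ.+ j))) (pochInv-sucˡ i j))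
                ⟨ ≗-trans ⟩ antidiagonal-⊛ N (qpow ∘ suc) pochInv) ⟩
  Pₒ N ⊕ qpow (suc N) ⊛ Pₑ N
    ∎
  where
  open ≗-Reasoning
  A B : ℕ → ℕ → Series
  A i j = qpow i ⊛ (oneMinusQ^ j ⊛ pochInv i j)
  B i j = qpow (i ℕ.+ j) ⊛ (oneMinusQ^ i ⊛ pochInv i j)

Pₑ-step : ∀ N → oneMinusQ^ (suc N) ⊛ Pₑ (suc N) ≗ Pₑ N ⊕ Pₒ N
Pₑ-step N = begin
  oneMinusQ^ (suc N) ⊛ Pₑ (suc N)
    ≈⟨ antidiagonal-⊛ (suc N) oneMinusQ^ pochInv ⟨
  antidiagonal (suc N) (λ i j → oneMinusQ^ (i ℕ.+ j) ⊛ pochInv i j)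
    ≈⟨ antidiagonal-cong (suc N) (λ i j → split-oneMinusQ^ i j (pochInv i j)) ⟩
  antidiagonal (suc N) (λ i j → A i j ⊕ B i j)
    ≈⟨ antidiagonal-⊕ (suc N) A B ⟩
  antidiagonal (suc N) A ⊕ antidiagonal (suc N) B
    ≈⟨ +-cong (antidiagonal-dropˡ N A (oneMinusQ^-zero-⊛ (pochInv 0 (suc N))))
              (antidiagonal-dropʳ N B (⊛-oneMinusQ^-zero-⊛ (qpow (suc N)) (pochInv (suc N) 0))) ⟩
  antidiagonal N (λ i j → A (suc i) j) ⊕ antidiagonal N (λ i j → B i (suc j))
    ≈⟨ +-cong (antidiagonal-cong N pochInv-sucˡ)
              (antidiagonal-cong N (λ i j → ⊛-congˡ (qpow i) (pochInv-sucʳ i j))) ⟩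
  Pₑ N ⊕ Pₒ N
    ∎
  where
  open ≗-Reasoning
  A B : ℕ → ℕ → Series
  A i j = oneMinusQ^ i ⊛ pochInv i j
  B i j = qpow i ⊛ (oneMinusQ^ j ⊛ pochInv i j)

Pₑ-suc : ∀ N → Pₑ (suc N) ≗ Pₑ N ⊕ Pₒ (suc N)
Pₑ-suc N = proj₁ (oneMinusQ^-system N (Pₒ (suc N)) (Pₑ (suc N)) (Pₒ N) (Pₑ N) (Pₒ-step N) (Pₑ-step N))

Pₒ-suc : ∀ N → Pₒ (suc N) ≗ Pₒ N ⊕ shift (suc N) (Pₑ (suc N))
Pₒ-suc N = proj₂ (oneMinusQ^-system N (Pₒ (suc N)) (Pₑ (suc N)) (Pₒ N) (Pₑ N) (Pₒ-step N) (Pₑ-step N))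
  ⟨ ≗-trans ⟩ ⊕-congˡ (Pₒ N) (qpow-⊛ (suc N) (Pₑ (suc N)))

Dₑ-suc : ∀ N → Dₑ (suc N) ≗ Dₑ N ⊕ Dₒ N
Dₑ-suc N = begin
  (poch N ⊛ oneMinusQ^ (suc N)) ⊛ Pₑ (suc N)   ≈⟨ ⊛-assoc (poch N) (oneMinusQ^ (suc N)) (Pₑ (suc N)) ⟩
  poch N ⊛ (oneMinusQ^ (suc N) ⊛ Pₑ (suc N))   ≈⟨ ⊛-congˡ (poch N) (Pₑ-step N) ⟩
  poch N ⊛ (Pₑ N ⊕ Pₒ N)                       ≈⟨ ⊛-distribˡ (poch N) (Pₑ N) (Pₒ N) ⟩
  Dₑ N ⊕ Dₒ N                                  ∎
  where open ≗-Reasoning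

Dₒ-suc : ∀ N → Dₒ (suc N) ≗ Dₒ N ⊕ shift (suc N) (Dₑ N)
Dₒ-suc N = begin
  (poch N ⊛ oneMinusQ^ (suc N)) ⊛ Pₒ (suc N)   ≈⟨ ⊛-assoc (poch N) (oneMinusQ^ (suc N)) (Pₒ (suc N)) ⟩
  poch N ⊛ (oneMinusQ^ (suc N) ⊛ Pₒ (suc N))   ≈⟨ ⊛-congˡ (poch N) (Pₒ-step N) ⟩
  poch N ⊛ (Pₒ N ⊕ qpow (suc N) ⊛ Pₑ N)        ≈⟨ distribute (poch N) (Pₒ N) (qpow (suc N)) (Pₑ N) ⟩
  Dₒ N ⊕ qpow (suc N) ⊛ Dₑ N                   ≈⟨ ⊕-congˡ (Dₒ N) (qpow-⊛ (suc N) (Dₑ N)) ⟩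
  Dₒ N ⊕ shift (suc N) (Dₑ N)                  ∎
  where
  open ≗-Reasoning
  distribute : ∀ p x q y → p ⊛ (x ⊕ q ⊛ y) ≗ p ⊛ x ⊕ q ⊛ (p ⊛ y)
  distribute = solve 4 (λ p x q y → p :* (x :+ q :* y) := p :* x :+ q :* (p :* y)) (λ _ → refl)

Pₒ-zero : Pₒ 0 ≗ one
Pₒ-zero = ⊛-cong qpow-zero pochInv-zero ⟨ ≗-trans ⟩ ⊛-identityˡ one

Pₑ-zero : Pₑ 0 ≗ one
Pₑ-zero = pochInv-zero

Dₒ-zero : Dₒ 0 ≗ one
Dₒ-zero = ⊛-identityˡ (Pₒ 0) ⟨ ≗-trans ⟩ Pₒ-zero

Dₑ-zero : Dₑ 0 ≗ one
Dₑ-zero = ⊛-identityˡ (Pₑ 0) ⟨ ≗-trans ⟩ Pₑ-zero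

sumTo≗Pₒ : ∀ N → sumTo N (λ i → qpow i ⊛ inv (poch i ⊛ poch (N ∸ i))) ≗ Pₒ N
sumTo≗Pₒ N = sumTo-antidiagonal N (λ i j → qpow i ⊛ pochInv i j)

sumTo≗Dₒ : ∀ N → sumTo N (λ i → gauss i (N ∸ i) ⊛ qpow i) ≗ Dₒ N
sumTo≗Dₒ N = sumTo-antidiagonal N (λ i j → gauss i j ⊛ qpow i)
  ⟨ ≗-trans ⟩ antidiagonal-cong N gauss-⊛-qpow
  ⟨ ≗-trans ⟩ antidiagonal-⊛ N poch (λ i j → qpow i ⊛ pochInv i j)
  where
  rearrange : ∀ p w q → (p ⊛ w) ⊛ q ≗ p ⊛ (q ⊛ w)
  rearrange = solve 3 (λ p w q → (p :* w) :* q := p :* (q :* w)) (λ _ → refl)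
  gauss-⊛-qpow : ∀ i j → gauss i j ⊛ qpow i ≗ poch (i ℕ.+ j) ⊛ (qpow i ⊛ pochInv i j)
  gauss-⊛-qpow i j = ⊛-congʳ (qpow i) (gauss≗ i j) ⟨ ≗-trans ⟩ rearrange (poch (i ℕ.+ j)) (pochInv i j) (qpow i)

ℰ : List ℕ → ℕ
ℰ []      = 0
ℰ (_ ∷ r) = 𝒪 r

𝒪-∷ : ∀ x r → 𝒪 (x ∷ r) ≡ x ℕ.+ ℰ r
𝒪-∷ x []      = sym (ℕP.+-identityʳ x)
𝒪-∷ x (_ ∷ _) = refl

Fiber : (List ℕ → Set) → (List ℕ → ℕ) → ℕ → Set
Fiber S f n = Σ (List ℕ) (λ π → S π × f π ≡ n)

HasSize : Set → ℤ → Set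
HasSize A z = Σ ℕ λ c → (Fin c ↔ A) × z ≡ + c

Counts : (List ℕ → Set) → (List ℕ → ℕ) → Series → Set
Counts S f F = ∀ n → HasSize (Fiber S f n) (F n)

hasSize-resp : ∀ {A z z′} → z′ ≡ z → HasSize A z → HasSize A z′
hasSize-resp z′≡z (c , Fin↔A , z≡c) = c , Fin↔A , trans z′≡z z≡c

counts-resp : ∀ {S f F G} → G ≗ F → Counts S f F → Counts S f G
counts-resp G≗F counts n = hasSize-resp (G≗F n) (counts n)

hasSize-↔ : ∀ {A B z} → A ↔ B → HasSize A z → HasSize B z
hasSize-↔ A↔B (c , Fin↔A , z≡c) = c , ↔-trans Fin↔A A↔B , z≡c

hasSize-⊎ : ∀ {A B a b} → HasSize A a → HasSize B b → HasSize (A ⊎ B) (a ℤ.+ b)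
hasSize-⊎ (c , Fin↔A , a≡c) (d , Fin↔B , b≡d) = c ℕ.+ d , ↔-trans +↔⊎ (Fin↔A ⊎-↔ Fin↔B) , cong₂ ℤ._+_ a≡c b≡d

hasSize-⊥ : ∀ {A} → ¬ A → HasSize A (+ 0)
hasSize-⊥ ¬a = 0 , mk↔ₛ′ (λ ()) (⊥-elim ∘ ¬a) (⊥-elim ∘ ¬a) (λ ()) , refl

hasSize-singleton : ∀ {A} (a : A) → (∀ x → x ≡ a) → HasSize A (+ 1)
hasSize-singleton a unique =
  1 , mk↔ₛ′ (λ _ → a) (λ _ → Fin.zero) (λ x → sym (unique x)) (λ { Fin.zero → refl ; (Fin.suc ()) }) , refl

fiber-≡ : ∀ {S f n} → Irrelevant S → {π π′ : List ℕ} {s : S π} {s′ : S π′} {e : f π ≡ n} {e′ : f π′ ≡ n} →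
  π ≡ π′ → _≡_ {A = Fiber S f n} (π , s , e) (π′ , s′ , e′)
fiber-≡ S-irr refl = cong₂ (λ s e → _ , s , e) (S-irr _ _) (ℕP.≡-irrelevant _ _)

fiber-cong : ∀ {S f g} → Irrelevant S → (∀ π → f π ≡ g π) → ∀ n → Fiber S f n ↔ Fiber S g n
fiber-cong S-irr f≗g n = mk↔ₛ′
  (λ (π , s , e) → π , s , trans (sym (f≗g π)) e)
  (λ (π , s , e) → π , s , trans (f≗g π) e)
  (λ _ → fiber-≡ S-irr refl) (λ _ → fiber-≡ S-irr refl)

fiber-+ : ∀ {S f n} k → Irrelevant S → k ≤ n → Fiber S (λ π → k ℕ.+ f π) n ↔ Fiber S f (n ∸ k)
fiber-+ {f = f} k S-irr k≤n = mk↔ₛ′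
  (λ (π , s , e) → π , s , trans (sym (ℕP.m+n∸m≡n k (f π))) (cong (_∸ k) e))
  (λ (π , s , e) → π , s , trans (cong (k ℕ.+_) e) (ℕP.m+[n∸m]≡n k≤n))
  (λ _ → fiber-≡ S-irr refl) (λ _ → fiber-≡ S-irr refl)

shift-≤ : ∀ k F n → k ≤ n → shift k F n ≡ F (n ∸ k)
shift-≤ zero    F n       _         = refl
shift-≤ (suc k) F (suc n) (s≤s k≤n) = shift-≤ k F n k≤n

shift-< : ∀ k F n → n < k → shift k F n ≡ + 0
shift-< (suc k) F zero    _         = refl
shift-< (suc k) F (suc n) (s≤s n<k) = shift-< k F n n<k

hasSize-leadingPart : ∀ {R} k F n → Irrelevant R → (k ≤ n → HasSize (Fiber R ℰ (n ∸ k)) (F (n ∸ k))) →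
  HasSize (Fiber R (λ r → 𝒪 (k ∷ r)) n) (shift k F n)
hasSize-leadingPart k F n R-irr counts with k ℕP.≤? n
... | yes k≤n = hasSize-resp (shift-≤ k F n k≤n)
                  (hasSize-↔ (↔-sym (fiber-+ k R-irr k≤n) ⟨ ↔-trans ⟩ fiber-cong R-irr (sym ∘ 𝒪-∷ k) n) (counts k≤n))
... | no k≰n  = hasSize-resp (shift-< k F n (ℕP.≰⇒> k≰n))
                  (hasSize-⊥ λ (r , _ , e) → k≰n (subst (k ≤_) (trans (sym (𝒪-∷ k r)) e) (ℕP.m≤m+n k (ℰ r))))

-- Members of S (parts ≤ M+1) have largest part ≤ M, and lie in Sₘ, or are M+1 ∷ r with r in R.
record LargestPartSplit (M : ℕ) (S Sₘ R : List ℕ → Set) : Set where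
  field
    S-irrelevant  : Irrelevant S
    Sₘ-irrelevant : Irrelevant Sₘ
    R-irrelevant  : Irrelevant R
    Sₘ-[]         : Sₘ []
    Sₘ⇒S          : ∀ {π} → Sₘ π → S π
    S⇒Sₘ          : ∀ {x r} → S (x ∷ r) → x ≤ M → Sₘ (x ∷ r)
    Sₘ-head       : ∀ {x r} → Sₘ (x ∷ r) → x ≤ M
    S-head        : ∀ {x r} → S (x ∷ r) → x ≤ suc M
    S-tail        : ∀ {x r} → S (x ∷ r) → R r
    S-cons        : ∀ {r} → R r → S (suc M ∷ r)

fiber-split : ∀ {M S Sₘ R} → LargestPartSplit M S Sₘ R → ∀ f n →
  Fiber S f n ↔ (Fiber Sₘ f n ⊎ Fiber R (λ r → f (suc M ∷ r)) n)
fiber-split {M} {S} {Sₘ} {R} split f n = mk↔ₛ′ to from to∘from from∘to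
  where
  open LargestPartSplit split
  x≡1+M : ∀ {x r} → S (x ∷ r) → ¬ x ≤ M → x ≡ suc M
  x≡1+M s x≰M = ℕP.≤-antisym (S-head s) (ℕP.≰⇒> x≰M)
  to : Fiber S f n → Fiber Sₘ f n ⊎ Fiber R (λ r → f (suc M ∷ r)) n
  to ([]    , _ , e) = inj₁ ([] , Sₘ-[] , e)
  to (x ∷ r , s , e) with x ℕP.≤? M
  ... | yes x≤M = inj₁ (x ∷ r , S⇒Sₘ s x≤M , e)
  ... | no x≰M  = inj₂ (r , S-tail s , subst (λ y → f (y ∷ r) ≡ n) (x≡1+M s x≰M) e)
  from : Fiber Sₘ f n ⊎ Fiber R (λ r → f (suc M ∷ r)) n → Fiber S f n
  from (inj₁ (π , s , e)) = π , Sₘ⇒S s , e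
  from (inj₂ (r , s , e)) = suc M ∷ r , S-cons s , e
  to∘from : ∀ b → to (from b) ≡ b
  to∘from (inj₁ ([] , _ , _)) = cong inj₁ (fiber-≡ Sₘ-irrelevant refl)
  to∘from (inj₁ (x ∷ r , s , _)) with x ℕP.≤? M
  ... | yes _   = cong inj₁ (fiber-≡ Sₘ-irrelevant refl)
  ... | no x≰M  = ⊥-elim (x≰M (Sₘ-head s))
  to∘from (inj₂ (r , _ , _)) with suc M ℕP.≤? M
  ... | yes 1+M≤M = ⊥-elim (ℕP.1+n≰n 1+M≤M)
  ... | no _      = cong inj₂ (fiber-≡ R-irrelevant refl)
  from∘to : ∀ a → from (to a) ≡ a
  from∘to ([] , _ , _) = fiber-≡ S-irrelevant refl
  from∘to (x ∷ r , s , e) with x ℕP.≤? M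
  ... | yes _   = fiber-≡ S-irrelevant refl
  ... | no x≰M  = fiber-≡ S-irrelevant (cong (_∷ r) (sym (x≡1+M s x≰M)))

hasSize-split : ∀ {M S Sₘ R a b} → LargestPartSplit M S Sₘ R → ∀ f n →
  HasSize (Fiber Sₘ f n) a → HasSize (Fiber R (λ r → f (suc M ∷ r)) n) b → HasSize (Fiber S f n) (a ℤ.+ b)
hasSize-split split f n sizeₘ sizeᵣ = hasSize-↔ (↔-sym (fiber-split split f n)) (hasSize-⊎ sizeₘ sizeᵣ)

counts-[] : ∀ {S F} → Irrelevant S → S [] → (∀ {x r} → ¬ S (x ∷ r)) → F ≗ one → ∀ f → f [] ≡ 0 → Counts S f F
counts-[] S-irr s[] ¬s∷ F≗1 f f[]≡0 zero = hasSize-resp (F≗1 0) (hasSize-singleton ([] , s[] , f[]≡0) unique)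
  where
  unique : ∀ x → x ≡ ([] , s[] , f[]≡0)
  unique ([]    , _ , _) = fiber-≡ S-irr refl
  unique (_ ∷ _ , s , _) = ⊥-elim (¬s∷ s)
counts-[] S-irr s[] ¬s∷ F≗1 f f[]≡0 (suc n) = hasSize-resp (F≗1 (suc n)) (hasSize-⊥ empty)
  where
  empty : ¬ Fiber _ f (suc n)
  empty ([]    , _ , e) with () ← trans (sym f[]≡0) e
  empty (_ ∷ _ , s , _) = ¬s∷ s

IsPartition-irrelevant : Irrelevant IsPartition
IsPartition-irrelevant (a , l) (a′ , l′) =
  cong₂ _,_ (All.irrelevant ℕP.≤-irrelevant a a′) (Linked.irrelevant ℕP.≤-irrelevant l l′)

InD-irrelevant : ∀ N → Irrelevant (InD≤ N)
InD-irrelevant N (p , l , a) (p′ , l′ , a′) =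
  cong₂ _,_ (IsPartition-irrelevant p p′)
            (cong₂ _,_ (Linked.irrelevant ℕP.<-irrelevant l l′) (All.irrelevant ℕP.≤-irrelevant a a′))

InP-irrelevant : ∀ N → Irrelevant (InP≤ N)
InP-irrelevant N (p , a) (p′ , a′) = cong₂ _,_ (IsPartition-irrelevant p p′) (All.irrelevant ℕP.≤-irrelevant a a′)

bounded-by-head : ∀ {M x r} → Linked _≥_ (x ∷ r) → x ≤ M → All (_≤ M) (x ∷ r)
bounded-by-head {r = []}    _         x≤M = x≤M ∷ []
bounded-by-head {r = _ ∷ _} (y≤x ∷ l) x≤M = x≤M ∷ bounded-by-head l (ℕP.≤-trans y≤x x≤M)

All≤-suc : ∀ {M π} → All (_≤ M) π → All (_≤ suc M) π
All≤-suc = All.map ℕP.m≤n⇒m≤1+n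

D-split : ∀ M → LargestPartSplit M (InD≤ (suc M)) (InD≤ M) (InD≤ M)
D-split M = record
  { S-irrelevant  = InD-irrelevant (suc M)
  ; Sₘ-irrelevant = InD-irrelevant M
  ; R-irrelevant  = InD-irrelevant M
  ; Sₘ-[]         = ([] , []) , [] , []
  ; Sₘ⇒S          = λ (p , l , a) → p , l , All≤-suc a
  ; S⇒Sₘ          = λ ((a , l) , l′ , _) x≤M → (a , l) , l′ , bounded-by-head l x≤M
  ; Sₘ-head       = λ { (_ , _ , x≤M ∷ _) → x≤M }
  ; S-head        = λ { (_ , _ , x≤1+M ∷ _) → x≤1+M }
  ; S-tail        = tail≤
  ; S-cons        = cons
  }
  where
  tail≤ : ∀ {x r} → InD≤ (suc M) (x ∷ r) → InD≤ M r
  tail≤ {r = []}    _ = ([] , []) , [] , []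
  tail≤ {r = _ ∷ _} ((_ ∷ a , _ ∷ l) , y<x ∷ l′ , x≤1+M ∷ _) =
    (a , l) , l′ , bounded-by-head l (ℕP.≤-pred (ℕP.≤-trans y<x x≤1+M))
  cons : ∀ {r} → InD≤ M r → InD≤ (suc M) (suc M ∷ r)
  cons {[]}    _                     = (s≤s z≤n ∷ [] , [-]) , [-] , ℕP.≤-refl ∷ []
  cons {_ ∷ _} ((a , l) , l′ , y≤M ∷ b) =
    (s≤s z≤n ∷ a , ℕP.m≤n⇒m≤1+n y≤M ∷ l) , s≤s y≤M ∷ l′ , ℕP.≤-refl ∷ All≤-suc (y≤M ∷ b)

P-split : ∀ M → LargestPartSplit M (InP≤ (suc M)) (InP≤ M) (InP≤ (suc M))
P-split M = record
  { S-irrelevant  = InP-irrelevant (suc M)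
  ; Sₘ-irrelevant = InP-irrelevant M
  ; R-irrelevant  = InP-irrelevant (suc M)
  ; Sₘ-[]         = ([] , []) , []
  ; Sₘ⇒S          = λ (p , a) → p , All≤-suc a
  ; S⇒Sₘ          = λ ((a , l) , _) x≤M → (a , l) , bounded-by-head l x≤M
  ; Sₘ-head       = λ { (_ , x≤M ∷ _) → x≤M }
  ; S-head        = λ { (_ , x≤1+M ∷ _) → x≤1+M }
  ; S-tail        = λ { ((_ ∷ a , l) , _ ∷ b) → (a , Linked.tail l) , b }
  ; S-cons        = cons
  }
  where
  cons : ∀ {r} → InP≤ (suc M) r → InP≤ (suc M) (suc M ∷ r)
  cons {[]}    _                     = (s≤s z≤n ∷ [] , [-]) , ℕP.≤-refl ∷ []
  cons {_ ∷ _} ((a , l) , y≤1+M ∷ b) = (s≤s z≤n ∷ a , y≤1+M ∷ l) , ℕP.≤-refl ∷ y≤1+M ∷ b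

¬InD≤0 : ∀ {x r} → ¬ InD≤ 0 (x ∷ r)
¬InD≤0 ((s≤s _ ∷ _ , _) , _ , () ∷ _)

¬InP≤0 : ∀ {x r} → ¬ InP≤ 0 (x ∷ r)
¬InP≤0 ((s≤s _ ∷ _ , _) , () ∷ _)

D-counts : ∀ N → Counts (InD≤ N) 𝒪 (Dₒ N) × Counts (InD≤ N) ℰ (Dₑ N)
D-counts zero =
    counts-[] (InD-irrelevant 0) (([] , []) , [] , []) ¬InD≤0 Dₒ-zero 𝒪 refl
  , counts-[] (InD-irrelevant 0) (([] , []) , [] , []) ¬InD≤0 Dₑ-zero ℰ refl
D-counts (suc M) = countsₒ , countsₑ
  where
  countsₒ : Counts (InD≤ (suc M)) 𝒪 (Dₒ (suc M))
  countsₒ n = hasSize-resp (Dₒ-suc M n) (hasSize-split (D-split M) 𝒪 n (proj₁ (D-counts M) n)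
    (hasSize-leadingPart (suc M) (Dₑ M) n (InD-irrelevant M) (λ _ → proj₂ (D-counts M) (n ∸ suc M))))
  countsₑ : Counts (InD≤ (suc M)) ℰ (Dₑ (suc M))
  countsₑ n = hasSize-resp (Dₑ-suc M n)
    (hasSize-split (D-split M) ℰ n (proj₂ (D-counts M) n) (proj₁ (D-counts M) n))

P-counts : ∀ N → Counts (InP≤ N) 𝒪 (Pₒ N) × Counts (InP≤ N) ℰ (Pₑ N)
P-counts zero =
    counts-[] (InP-irrelevant 0) (([] , []) , []) ¬InP≤0 Pₒ-zero 𝒪 refl
  , counts-[] (InP-irrelevant 0) (([] , []) , []) ¬InP≤0 Pₑ-zero ℰ refl
P-counts (suc M) = proj₁ ∘ both , proj₂ ∘ both
  where
  -- Pₒ (M+1) at n needs Pₑ (M+1) at n ∸ (M+1), which needs Pₒ (M+1) there: strong induction on n.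
  Both : ℕ → Set
  Both n = HasSize (Fiber (InP≤ (suc M)) 𝒪 n) (Pₒ (suc M) n)
         × HasSize (Fiber (InP≤ (suc M)) ℰ n) (Pₑ (suc M) n)
  both : ∀ n → Both n
  both = <-rec Both λ n below →
    let sizeₒ = hasSize-resp (Pₒ-suc M n) (hasSize-split (P-split M) 𝒪 n (proj₁ (P-counts M) n)
                  (hasSize-leadingPart (suc M) (Pₑ (suc M)) n (InP-irrelevant (suc M))
                     (λ 1+M≤n → proj₂ (below (ℕP.∸-monoʳ-< (s≤s z≤n) 1+M≤n)))))
    in sizeₒ , hasSize-resp (Pₑ-suc M n) (hasSize-split (P-split M) ℰ n (proj₂ (P-counts M) n) sizeₒ)

theorem3p2 : (N : ℕ) →
    IsOGF (InD≤ N) (sumTo N (λ i → gauss i (N ∸ i) ⊛ qpow i))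
    × IsOGF (InP≤ N) (sumTo N (λ i → qpow i ⊛ inv (poch i ⊛ poch (N ∸ i))))
theorem3p2 N = counts-resp (sumTo≗Dₒ N) (proj₁ (D-counts N))
             , counts-resp (sumTo≗Pₒ N) (proj₁ (P-counts N))
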